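{- The basic entailment relation $\vdash^b$ of transition algebra is compact: for every signature $\Sigma$, every set $\Gamma$ of $\Sigma$-sentences and every $\Sigma$-sentence $\phi$, if $\Gamma\vdash^b_\Sigma\phi$ then $\Gamma_0\vdash^b_\Sigma\phi$ for some finite subset $\Gamma_0\subseteq\Gamma$.
   Context: Transition algebra (TA). A signature $\Sigma=(S,F\supseteq M,L)$ consists of a set $S$ of sorts, a family $F=\{F_{w,s}\}$ of sets of function symbols ($\sigma\colon w\to s$), a subfamily $M\subseteq F$ of monotonic function symbols, and a set $L$ of transition labels; signature morphisms $\chi\colon\Sigma\to\Sigma'$ are algebraic signature morphisms with $\chi(M)\subseteq M'$ plus a map $L\to L'$. Actions: $\mathfrak a::=\lambda\mid\mathfrak a\mathbin{;}\mathfrak a\mid\mathfrak a\cup\mathfrak a\mid\mathfrak a^*$ ($\lambda\in L$). $\Sigma$-sentences: $\phi::=t_1=t_2\mid t_1\stackrel{\mathfrak a}\Rightarrow t_2\mid\neg\phi\mid\bigvee\Phi\mid\exists X\,\phi'$ ($t_i$ ground terms of equal sort, $\Phi$ finite, $X$ a finite set of variables added as new constants giving $\Sigma[X]$, $\phi'$ a $\Sigma[X]$-sentence); $\mathrm{Sen}(\Sigma)$ is their set, and sentences translate along signature morphisms $\chi$ in the evident homomorphic way (written $\chi(\phi)$). An entailment relation $\vdash=\{\vdash_\Sigma\}_\Sigma$ is a family of relations $\vdash_\Sigma\subseteq\mathcal P(\mathrm{Sen}(\Sigma))\times\mathcal P(\mathrm{Sen}(\Sigma))$ such that: (Monotonicity)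 $\Gamma\supseteq\Phi$ implies $\Gamma\vdash_\Sigma\Phi$; (Transitivity) $\Gamma\vdash_\Sigma\Phi$ and $\Phi\vdash_\Sigma\Psi$ imply $\Gamma\vdash_\Sigma\Psi$; (Union) $\Gamma\vdash_\Sigma\phi$ for all $\phi\in\Phi$ implies $\Gamma\vdash_\Sigma\Phi$; (Translation) $\Gamma\vdash_\Sigma\Phi$ implies $\chi(\Gamma)\vdash_{\Sigma'}\chi(\Phi)$ for every $\chi\colon\Sigma\to\Sigma'$. One writes $\Gamma\vdash\phi$ for $\Gamma\vdash\{\phi\}$. The basic entailment relation $\vdash^b$ is the least entailment relation closed under the following rules (for all $\Gamma$ and terms): (R) $\Gamma\vdash t=t$; (S) from $\Gamma\vdash t_1=t_2$ infer $\Gamma\vdash t_2=t_1$; (T) from $\Gamma\vdash t_1=t_2$ and $\Gamma\vdash t_2=t_3$ infer $\Gamma\vdash t_1=t_3$; (F) from $\Gamma\vdash t_i=t_i'$ for $1\le i\le n$ infer $\Gamma\vdash\sigma(t_1,\dots,t_n)=\sigma(t_1',\dots,t_n')$; (P) from $\Gamma\vdash t_1=t_1'$, $\Gamma\vdash t_2=t_2'$ and $\Gamma\vdash t_1\stackrel{\lambda}\Rightarrow t_2$ infer $\Gamma\vdash t_1'\stackrel{\lambda}\Rightarrow t_2'$ ($\lambda\in L$); (M) for $f\in M$, from $\Gamma\vdash t_j\stackrel{\lambda}\Rightarrow u_j$ infer $\Gamma\vdash f(t_1,\dots,t_j,\dots,t_n)\stackrel{\lambda}\Rightarrow f(t_1,\dots,u_j,\dots,t_n)$.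 -}

module Defs where

open import Level using (Level)
open import Data.Nat using (ℕ)
open import Data.Fin using (Fin)
open import Data.List using (List; []; _∷_; map)
open import Data.List.Relation.Unary.All using (All; []; _∷_)
open import Data.List.Membership.Propositional using (_∈_)
open import Data.Product using (Σ-syntax; _×_; _,_; ∃)
open import Data.Sum using (_⊎_; inj₁; inj₂)
open import Data.Empty using (⊥)
open import Relation.Binary.PropositionalEquality using (_≡_; refl)

record Sig : Set₁ where
  field
    S    : Set
    F    : List S → S → Set
    Mono : ∀ {w s} → F w s → Set          -- M ⊆ F (membership predicate)
    L    : Set                            -- transition labels
open Sig public

record Mor (Σ₁ Σ₂ : Sig) : Set where
  field
    sort : S Σ₁ → S Σ₂
    op   : ∀ {w s} → F Σ₁ w s → F Σ₂ (map sort w) (sort s)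
    mono : ∀ {w s} (f : F Σ₁ w s) → Mono Σ₁ f → Mono Σ₂ (op f)
    labMap : L Σ₁ → L Σ₂
open Mor public

data Term (Σ₀ : Sig) : S Σ₀ → Set where
  app : ∀ {w s} → F Σ₀ w s → All (Term Σ₀) w → Term Σ₀ s

data Act (Lb : Set) : Set where
  lab  : Lb → Act Lb
  _⨾_  : Act Lb → Act Lb → Act Lb
  _∪ₐ_ : Act Lb → Act Lb → Act Lb
  _*   : Act Lb → Act Lb

-- Σ[X]: a finite set X of n sorted variables added as new constants

Vars : Sig → Set
Vars Σ₀ = Σ[ n ∈ ℕ ] (Fin n → S Σ₀)

NewConst : (Σ₀ : Sig) → Vars Σ₀ → List (S Σ₀) → S Σ₀ → Set
NewConst Σ₀ (n , srt) w s = (w ≡ []) × (Σ[ i ∈ Fin n ] srt i ≡ s)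

ExtMono : (Σ₀ : Sig) (X : Vars Σ₀) → ∀ {w s} → F Σ₀ w s ⊎ NewConst Σ₀ X w s → Set
ExtMono Σ₀ X (inj₁ f) = Mono Σ₀ f
ExtMono Σ₀ X (inj₂ _) = ⊥

_[_] : (Σ₀ : Sig) → Vars Σ₀ → Sig
Σ₀ [ X ] = record
  { S    = S Σ₀
  ; F    = λ w s → F Σ₀ w s ⊎ NewConst Σ₀ X w s
  ; Mono = ExtMono Σ₀ X
  ; L    = L Σ₀
  }

data Sen : Sig → Set₁ where
  _≐_   : ∀ {Σ₀ s} → Term Σ₀ s → Term Σ₀ s → Sen Σ₀
  _⟹⟨_⟩_ : ∀ {Σ₀ s} → Term Σ₀ s → Act (L Σ₀) → Term Σ₀ s → Sen Σ₀
  ¬ₛ_   : ∀ {Σ₀} → Sen Σ₀ → Sen Σ₀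
  ⋁     : ∀ {Σ₀} → List (Sen Σ₀) → Sen Σ₀
  ∃ₛ    : ∀ {Σ₀} (X : Vars Σ₀) → Sen (Σ₀ [ X ]) → Sen Σ₀

mapAct : ∀ {A B : Set} → (A → B) → Act A → Act B
mapAct g (lab x) = lab (g x)
mapAct g (a ⨾ b) = mapAct g a ⨾ mapAct g b
mapAct g (a ∪ₐ b) = mapAct g a ∪ₐ mapAct g b
mapAct g (a *) = mapAct g a *

mutual
  trTerm : ∀ {Σ₁ Σ₂} (χ : Mor Σ₁ Σ₂) {s} → Term Σ₁ s → Term Σ₂ (sort χ s)
  trTerm χ (app f ts) = app (op χ f) (trArgs χ ts)

  trArgs : ∀ {Σ₁ Σ₂} (χ : Mor Σ₁ Σ₂) {w} → All (Term Σ₁) w → All (Term Σ₂) (map (sort χ) w)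
  trArgs χ [] = []
  trArgs χ (t ∷ ts) = trTerm χ t ∷ trArgs χ ts

trVars : ∀ {Σ₁ Σ₂} → Mor Σ₁ Σ₂ → Vars Σ₁ → Vars Σ₂
trVars χ (n , srt) = n , (λ i → sort χ (srt i))

extOp : ∀ {Σ₁ Σ₂} (χ : Mor Σ₁ Σ₂) (X : Vars Σ₁) {w s} →
        F (Σ₁ [ X ]) w s → F (Σ₂ [ trVars χ X ]) (map (sort χ) w) (sort χ s)
extOp χ X (inj₁ f) = inj₁ (op χ f)
extOp χ X (inj₂ (refl , i , refl)) = inj₂ (refl , i , refl)

extMono : ∀ {Σ₁ Σ₂} (χ : Mor Σ₁ Σ₂) (X : Vars Σ₁) {w s} (f : F (Σ₁ [ X ]) w s) →
          Mono (Σ₁ [ X ]) f → Mono (Σ₂ [ trVars χ X ]) (extOp χ X f)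
extMono χ X (inj₁ f) m = mono χ f m

extMor : ∀ {Σ₁ Σ₂} (χ : Mor Σ₁ Σ₂) (X : Vars Σ₁) → Mor (Σ₁ [ X ]) (Σ₂ [ trVars χ X ])
extMor χ X = record { sort = sort χ ; op = extOp χ X ; mono = extMono χ X ; labMap = labMap χ }

mutual
  trSen : ∀ {Σ₁ Σ₂} → Mor Σ₁ Σ₂ → Sen Σ₁ → Sen Σ₂
  trSen χ (t ≐ u) = trTerm χ t ≐ trTerm χ u
  trSen χ (t ⟹⟨ a ⟩ u) = trTerm χ t ⟹⟨ mapAct (labMap χ) a ⟩ trTerm χ u
  trSen χ (¬ₛ φ) = ¬ₛ trSen χ φ
  trSen χ (⋁ Φ) = ⋁ (trSens χ Φ)
  trSen χ (∃ₛ X φ) = ∃ₛ (trVars χ X) (trSen (extMor χ X) φ)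

  trSens : ∀ {Σ₁ Σ₂} → Mor Σ₁ Σ₂ → List (Sen Σ₁) → List (Sen Σ₂)
  trSens χ [] = []
  trSens χ (φ ∷ Φ) = trSen χ φ ∷ trSens χ Φ

SenSet : Sig → Set₂
SenSet Σ₀ = Sen Σ₀ → Set₁

⟦_⟧ : ∀ {Σ₀} → Sen Σ₀ → SenSet Σ₀
⟦ φ ⟧ ψ = ψ ≡ φ

_⊇_ : ∀ {Σ₀} → SenSet Σ₀ → SenSet Σ₀ → Set₁
Γ ⊇ Φ = ∀ φ → Φ φ → Γ φ

img : ∀ {Σ₁ Σ₂} → Mor Σ₁ Σ₂ → SenSet Σ₁ → SenSet Σ₂
img χ Γ ψ = ∃ λ φ → Γ φ × trSen χ φ ≡ ψ

listSet : ∀ {Σ₀} → List (Sen Σ₀) → SenSet Σ₀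
listSet Γ₀ ψ = ψ ∈ Γ₀

data Pw {Σ₀ : Sig} (R : ∀ {s} → Term Σ₀ s → Term Σ₀ s → Set₂) :
        ∀ {w} → All (Term Σ₀) w → All (Term Σ₀) w → Set₂ where
  []  : Pw R [] []
  _∷_ : ∀ {s w} {t u : Term Σ₀ s} {ts us : All (Term Σ₀) w} →
        R t u → Pw R ts us → Pw R (t ∷ ts) (u ∷ us)

data At1 {Σ₀ : Sig} (R : ∀ {s} → Term Σ₀ s → Term Σ₀ s → Set₂) :
        ∀ {w} → All (Term Σ₀) w → All (Term Σ₀) w → Set₂ where
  here  : ∀ {s w} {t u : Term Σ₀ s} {ts : All (Term Σ₀) w} →
          R t u → At1 R (t ∷ ts) (u ∷ ts)
  there : ∀ {s w} {t : Term Σ₀ s} {ts us : All (Term Σ₀) w} →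
          At1 R ts us → At1 R (t ∷ ts) (t ∷ us)

-- The basic entailment relation ⊢ᵇ: the least family of relations
-- satisfying Monotonicity, Transitivity, Union, Translation and closed
-- under (R),(S),(T),(F),(P),(M)  (inductively generated).

infix 4 _⊢ᵇ_

data _⊢ᵇ_ : ∀ {Σ₀} → SenSet Σ₀ → SenSet Σ₀ → Set₂ where
  monotonicity : ∀ {Σ₀} {Γ Φ : SenSet Σ₀} → Γ ⊇ Φ → Γ ⊢ᵇ Φ
  transitivity : ∀ {Σ₀} {Γ Φ Ψ : SenSet Σ₀} → Γ ⊢ᵇ Φ → Φ ⊢ᵇ Ψ → Γ ⊢ᵇ Ψ
  union        : ∀ {Σ₀} {Γ Φ : SenSet Σ₀} → (∀ φ → Φ φ → Γ ⊢ᵇ ⟦ φ ⟧) → Γ ⊢ᵇ Φ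
  translation  : ∀ {Σ₁ Σ₂} (χ : Mor Σ₁ Σ₂) {Γ Φ : SenSet Σ₁} →
                 Γ ⊢ᵇ Φ → img χ Γ ⊢ᵇ img χ Φ
  ruleR : ∀ {Σ₀} {Γ : SenSet Σ₀} {s} (t : Term Σ₀ s) → Γ ⊢ᵇ ⟦ t ≐ t ⟧
  ruleS : ∀ {Σ₀} {Γ : SenSet Σ₀} {s} {t₁ t₂ : Term Σ₀ s} →
          Γ ⊢ᵇ ⟦ t₁ ≐ t₂ ⟧ → Γ ⊢ᵇ ⟦ t₂ ≐ t₁ ⟧
  ruleT : ∀ {Σ₀} {Γ : SenSet Σ₀} {s} {t₁ t₂ t₃ : Term Σ₀ s} →
          Γ ⊢ᵇ ⟦ t₁ ≐ t₂ ⟧ → Γ ⊢ᵇ ⟦ t₂ ≐ t₃ ⟧ → Γ ⊢ᵇ ⟦ t₁ ≐ t₃ ⟧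
  ruleF : ∀ {Σ₀} {Γ : SenSet Σ₀} {w s} (σ : F Σ₀ w s) {ts us : All (Term Σ₀) w} →
          Pw (λ t u → Γ ⊢ᵇ ⟦ t ≐ u ⟧) ts us →
          Γ ⊢ᵇ ⟦ app σ ts ≐ app σ us ⟧
  ruleP : ∀ {Σ₀} {Γ : SenSet Σ₀} {s} {t₁ t₁' t₂ t₂' : Term Σ₀ s} (l : L Σ₀) →
          Γ ⊢ᵇ ⟦ t₁ ≐ t₁' ⟧ → Γ ⊢ᵇ ⟦ t₂ ≐ t₂' ⟧ → Γ ⊢ᵇ ⟦ t₁ ⟹⟨ lab l ⟩ t₂ ⟧ →
          Γ ⊢ᵇ ⟦ t₁' ⟹⟨ lab l ⟩ t₂' ⟧
  ruleM : ∀ {Σ₀} {Γ : SenSet Σ₀} {w s} (f : F Σ₀ w s) → Mono Σ₀ f → (l : L Σ₀)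
          {ts us : All (Term Σ₀) w} →
          At1 (λ t u → Γ ⊢ᵇ ⟦ t ⟹⟨ lab l ⟩ u ⟧) ts us →
          Γ ⊢ᵇ ⟦ app f ts ⟹⟨ lab l ⟩ app f us ⟧

-- Each rule has finitely many premises, so a derivation consults Γ only at
-- finitely many Monotonicity leaves.  Induction on the derivation collects
-- them into a list Γ₀ ⊆ Γ: rules with several premises use the union of the
-- premises' supports, Transitivity Γ ⊢ Φ ⊢ Ψ first finds a finite Φ₀ ⊆ Φ
-- supporting the conclusion and then a common support for all of Φ₀, and
-- Translation maps the support along χ.
module Submission where

open import Defs
open import Data.List using (List; []; _∷_; _++_; map)
open import Data.List.Membership.Propositional using (_∈_)
open import Data.List.Membership.Propositional.Properties using (∈-++⁻; ∈-map⁺; ∈-map⁻)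
open import Data.List.Relation.Binary.Subset.Propositional using (_⊆_)
open import Data.List.Relation.Binary.Subset.Propositional.Properties using (xs⊆xs++ys; xs⊆ys++xs)
open import Data.List.Relation.Unary.Any using (here; there)
open import Data.List.Relation.Unary.All using (All)
open import Data.Product using (∃; _×_; _,_)
open import Data.Sum using ([_,_])
open import Relation.Binary.PropositionalEquality using (refl; sym)

private
  variable
    Σ₀ Σ₁ Σ₂ : Sig

Finitely : SenSet Σ₀ → (List (Sen Σ₀) → Set₂) → Set₂
Finitely {Σ₀} Γ P = ∃ λ (Γ₀ : List (Sen Σ₀)) → (∀ ψ → ψ ∈ Γ₀ → Γ ψ) × P Γ₀

Monotone : (List (Sen Σ₀) → Set₂) → Set₂
Monotone P = ∀ {A B} → A ⊆ B → P A → P B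

module _ {Γ : SenSet Σ₀} where

  finitely-const : {P : List (Sen Σ₀) → Set₂} → P [] → Finitely Γ P
  finitely-const p = [] , (λ _ ()) , p

  finitely-map : {P Q : List (Sen Σ₀) → Set₂} →
                 (∀ {Γ₀} → P Γ₀ → Q Γ₀) → Finitely Γ P → Finitely Γ Q
  finitely-map f (Γ₀ , Γ₀⊆Γ , p) = Γ₀ , Γ₀⊆Γ , f p

  finitely-zip : {P Q : List (Sen Σ₀) → Set₂} → Monotone P → Monotone Q →
                 Finitely Γ P → Finitely Γ Q → Finitely Γ (λ Γ₀ → P Γ₀ × Q Γ₀)
  finitely-zip P-mono Q-mono (A , A⊆Γ , p) (B , B⊆Γ , q) =
    A ++ B ,
    (λ ψ ψ∈A++B → [ A⊆Γ ψ , B⊆Γ ψ ] (∈-++⁻ A ψ∈A++B)) ,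
    P-mono (xs⊆xs++ys A B) p ,
    Q-mono (xs⊆ys++xs B A) q

  finitely-all : {A : Set₁} {P : A → List (Sen Σ₀) → Set₂} →
                 (∀ x → Monotone (P x)) → (xs : List A) →
                 (∀ x → x ∈ xs → Finitely Γ (P x)) →
                 Finitely Γ (λ Γ₀ → ∀ x → x ∈ xs → P x Γ₀)
  finitely-all P-mono [] _ = finitely-const (λ _ ())
  finitely-all {P = P} P-mono (x ∷ xs) each =
    finitely-map cons
      (finitely-zip (P-mono x) all-mono
        (each x (here refl)) (finitely-all P-mono xs (λ y y∈xs → each y (there y∈xs))))
    where
    all-mono : Monotone (λ Γ₀ → ∀ y → y ∈ xs → P y Γ₀)
    all-mono A⊆B ps y y∈xs = P-mono y A⊆B (ps y y∈xs)

    cons : ∀ {Γ₀} → P x Γ₀ × (∀ y → y ∈ xs → P y Γ₀) → ∀ y → y ∈ x ∷ xs → P y Γ₀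
    cons (p , ps) y (here refl) = p
    cons (p , ps) y (there y∈xs) = ps y y∈xs

⊢ᵇ-mono : {Ψ : SenSet Σ₀} → Monotone (λ Γ₀ → listSet Γ₀ ⊢ᵇ Ψ)
⊢ᵇ-mono A⊆B = transitivity (monotonicity (λ _ → A⊆B))

⊢ᵇ-translate : (χ : Mor Σ₁ Σ₂) {Γ₀ : List (Sen Σ₁)} {φ : Sen Σ₁} →
               listSet Γ₀ ⊢ᵇ ⟦ φ ⟧ → listSet (map (trSen χ) Γ₀) ⊢ᵇ ⟦ trSen χ φ ⟧
⊢ᵇ-translate χ {φ = φ} Γ₀⊢φ =
  transitivity (monotonicity img⊆map) (transitivity (translation χ Γ₀⊢φ) (monotonicity ⟦⟧⊆img))
  where
  img⊆map : listSet (map (trSen χ) _) ⊇ img χ (listSet _)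
  img⊆map _ (ψ , ψ∈Γ₀ , refl) = ∈-map⁺ (trSen χ) ψ∈Γ₀

  ⟦⟧⊆img : img χ ⟦ φ ⟧ ⊇ ⟦ trSen χ φ ⟧
  ⟦⟧⊆img _ refl = φ , refl , refl

Pw-map : {R R′ : ∀ {s} → Term Σ₀ s → Term Σ₀ s → Set₂} →
         (∀ {s} {t u : Term Σ₀ s} → R t u → R′ t u) →
         ∀ {w} {ts us : All (Term Σ₀) w} → Pw R ts us → Pw R′ ts us
Pw-map f [] = []
Pw-map f (r ∷ rs) = f r ∷ Pw-map f rs

FinitelyEntails : SenSet Σ₀ → Sen Σ₀ → Set₂
FinitelyEntails Γ φ = Finitely Γ (λ Γ₀ → listSet Γ₀ ⊢ᵇ ⟦ φ ⟧)

finitely-translate : (χ : Mor Σ₁ Σ₂) {Γ : SenSet Σ₁} {φ : Sen Σ₁} →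
                     FinitelyEntails Γ φ → FinitelyEntails (img χ Γ) (trSen χ φ)
finitely-translate χ (Γ₀ , Γ₀⊆Γ , Γ₀⊢φ) = map (trSen χ) Γ₀ , support⊆img , ⊢ᵇ-translate χ Γ₀⊢φ
  where
  support⊆img : ∀ ψ → ψ ∈ map (trSen χ) Γ₀ → img χ _ ψ
  support⊆img ψ ψ∈ with ∈-map⁻ (trSen χ) ψ∈
  ... | φ , φ∈Γ₀ , ψ≡χφ = φ , Γ₀⊆Γ φ φ∈Γ₀ , sym ψ≡χφ

mutual
  compact : {Γ Φ : SenSet Σ₀} → Γ ⊢ᵇ Φ → ∀ φ → Φ φ → FinitelyEntails Γ φ
  compact (monotonicity Γ⊇Φ) φ φ∈Φ =
    φ ∷ [] , (λ { _ (here refl) → Γ⊇Φ φ φ∈Φ }) , monotonicity (λ { _ refl → here refl })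
  compact (transitivity Γ⊢Φ Φ⊢Ψ) φ φ∈Ψ with compact Φ⊢Ψ φ φ∈Ψ
  ... | Φ₀ , Φ₀⊆Φ , Φ₀⊢φ =
    finitely-map (λ Γ₀⊢Φ₀ → transitivity (union Γ₀⊢Φ₀) Φ₀⊢φ)
      (finitely-all (λ _ → ⊢ᵇ-mono) Φ₀ (λ ψ ψ∈Φ₀ → compact Γ⊢Φ ψ (Φ₀⊆Φ ψ ψ∈Φ₀)))
  compact (union Γ⊢Φ) φ φ∈Φ = compact (Γ⊢Φ φ φ∈Φ) φ refl
  compact (translation χ Γ⊢Φ) _ (φ , φ∈Φ , refl) = finitely-translate χ (compact Γ⊢Φ φ φ∈Φ)
  compact (ruleR t) _ refl = finitely-const (ruleR t)
  compact (ruleS d) _ refl = finitely-map ruleS (compact d _ refl)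
  compact (ruleT d₁ d₂) _ refl =
    finitely-map (λ (e₁ , e₂) → ruleT e₁ e₂)
      (finitely-zip ⊢ᵇ-mono ⊢ᵇ-mono (compact d₁ _ refl) (compact d₂ _ refl))
  compact (ruleF σ ds) _ refl = finitely-map (ruleF σ) (compact-Pw ds)
  compact (ruleP l d₁ d₂ d₃) _ refl =
    finitely-map (λ (e₁ , e₂ , e₃) → ruleP l e₁ e₂ e₃)
      (finitely-zip ⊢ᵇ-mono (λ A⊆B (e₂ , e₃) → ⊢ᵇ-mono A⊆B e₂ , ⊢ᵇ-mono A⊆B e₃)
        (compact d₁ _ refl)
        (finitely-zip ⊢ᵇ-mono ⊢ᵇ-mono (compact d₂ _ refl) (compact d₃ _ refl)))
  compact (ruleM f f-mono l ds) _ refl = finitely-map (ruleM f f-mono l) (compact-At1 ds)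

  compact-Pw : {Γ : SenSet Σ₀} {w : List (S Σ₀)} {ts us : All (Term Σ₀) w} →
               Pw (λ t u → Γ ⊢ᵇ ⟦ t ≐ u ⟧) ts us →
               Finitely Γ (λ Γ₀ → Pw (λ t u → listSet Γ₀ ⊢ᵇ ⟦ t ≐ u ⟧) ts us)
  compact-Pw [] = finitely-const []
  compact-Pw (d ∷ ds) =
    finitely-map (λ (e , es) → e ∷ es)
      (finitely-zip ⊢ᵇ-mono (λ A⊆B → Pw-map (⊢ᵇ-mono A⊆B)) (compact d _ refl) (compact-Pw ds))

  compact-At1 : {Γ : SenSet Σ₀} {w : List (S Σ₀)} {l : L Σ₀} {ts us : All (Term Σ₀) w} →
                At1 (λ t u → Γ ⊢ᵇ ⟦ t ⟹⟨ lab l ⟩ u ⟧) ts us →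
                Finitely Γ (λ Γ₀ → At1 (λ t u → listSet Γ₀ ⊢ᵇ ⟦ t ⟹⟨ lab l ⟩ u ⟧) ts us)
  compact-At1 (here d) = finitely-map here (compact d _ refl)
  compact-At1 (there ds) = finitely-map there (compact-At1 ds)

lemma3p5 : (Σ₀ : Sig) (Γ : SenSet Σ₀) (φ : Sen Σ₀) → Γ ⊢ᵇ ⟦ φ ⟧ →
           ∃ λ (Γ₀ : List (Sen Σ₀)) → (∀ ψ → ψ ∈ Γ₀ → Γ ψ) × (listSet Γ₀ ⊢ᵇ ⟦ φ ⟧)
lemma3p5 Σ₀ Γ φ Γ⊢φ = compact Γ⊢φ φ refl
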